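{- Let $a_1,\ldots,a_k, b$ be positive integers, let $c := \frac{\gcd(a_1,\ldots,a_k)}{\gcd(a_1,\ldots,a_k,b)}$, and suppose $bc\in\langle a_1,\ldots,a_k\rangle$. Then $$\langle a_1\rangle + \cdots + \langle a_k\rangle + \langle b\rangle = \big(\langle a_1\rangle + \cdots + \langle a_k\rangle\big)\oplus \{br : 0\le r<c\},$$ a reduction whose remainder set has cardinality $c$.
   Context: $\mathbb{N}$ = nonnegative integers; $\langle a\rangle := \{an : n\in\mathbb{N}\}$ and $\langle a_1,\dots,a_k\rangle := \langle a_1\rangle+\dots+\langle a_k\rangle$. For sets $A,B$ of integers, $A+B := \{x+y\}$, and $C=A\oplus B$ means $C=A+B$ with every element of $C$ having a unique representation $x+y$, $x\in A$, $y\in B$. -}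

module Defs where

open import Data.Nat using (ℕ; zero; suc; _+_; _*_; _<_; ≢-nonZero)
open import Data.Nat.DivMod using (_/_)
open import Data.Nat.GCD using (gcd; gcd[m,n]≢0)
open import Data.Fin using (Fin) renaming (zero to fzero; suc to fsuc)
open import Data.Product using (Σ; ∃; _×_; _,_)
open import Data.Sum using (inj₂)
open import Function using (_∘_)
open import Relation.Binary.PropositionalEquality using (_≡_)

NSet : Set₁
NSet = ℕ → Set

⟨_⟩ : ℕ → NSet
⟨ a ⟩ x = ∃ λ n → x ≡ a * n

_⊞_ : NSet → NSet → NSet
(A ⊞ B) x = ∃ λ y → ∃ λ z → A y × B z × x ≡ y + z

Gen : (k : ℕ) → (Fin k → ℕ) → NSet
Gen zero a x = x ≡ 0
Gen (suc k) a = ⟨ a fzero ⟩ ⊞ Gen k (a ∘ fsuc)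

_≐_ : NSet → NSet → Set
A ≐ B = ∀ x → (A x → B x) × (B x → A x)

IsDirectSum : NSet → NSet → NSet → Set
IsDirectSum C A B =
  (C ≐ (A ⊞ B)) ×
  (∀ y z y′ z′ → A y → B z → A y′ → B z′ → y + z ≡ y′ + z′ → (y ≡ y′) × (z ≡ z′))

gcdAll : (k : ℕ) → (Fin k → ℕ) → ℕ
gcdAll zero a = 0
gcdAll (suc k) a = gcd (a fzero) (gcdAll k (a ∘ fsuc))

-- c = gcd(a₁,…,a_k) / gcd(a₁,…,a_k,b); only meaningful for b > 0 (value 0 for b = 0).
-- Note gcd(a₁,…,a_k,b) = gcd(gcd(a₁,…,a_k), b).
cOf : (k : ℕ) → (Fin k → ℕ) → ℕ → ℕ
cOf k a zero = 0
cOf k a (suc b) =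
  let g = gcdAll k a in
  _/_ g (gcd g (suc b)) {{≢-nonZero (gcd[m,n]≢0 g (suc b) (inj₂ λ ()))}}

Remainders : ℕ → ℕ → NSet
Remainders b c x = ∃ λ r → r < c × x ≡ b * r

-- Every element of ⟨a₁,…,a_k⟩ is divisible by g = gcd(a₁,…,a_k), and g ∣ b t forces
-- c ∣ t because c = g / gcd(g,b) is coprime to b / gcd(g,b).  Hence two representations
-- y + b r = y' + b r' with 0 ≤ r ≤ r' < c differ by b (r' − r) with c ∣ r' − r < c, so
-- r = r'.  Existence is division with remainder: b n = b (n mod c) + ⌊n/c⌋ · b c, and
-- b c lies in the additive monoid ⟨a₁,…,a_k⟩.
module Submission where

open import Defs
open import Data.Nat using (ℕ; zero; suc; _+_; _*_; _∸_; _<_; _≤_; NonZero; ≢-nonZero; _/_; _%_)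
open import Data.Nat.Properties
open import Data.Nat.Divisibility
open import Data.Nat.DivMod using (m/n*n≡m; m≡m%n+[m/n]*n; m%n<n)
open import Data.Nat.GCD using (gcd; gcd[m,n]∣m; gcd[m,n]∣n; gcd[m,n]≢0; m/gcd[m,n]≢0)
open import Data.Nat.Coprimality using (coprime-/gcd; coprime-divisor)
open import Data.Nat.Tactic.RingSolver using (solve-∀)
open import Data.Fin using (Fin) renaming (zero to fzero; suc to fsuc)
open import Data.Product using (_×_; _,_)
open import Data.Sum using (inj₁; inj₂)
open import Data.Empty using (⊥-elim)
open import Function using (_∘_)
open import Relation.Binary.PropositionalEquality

record IsAdditiveSubmonoid (S : NSet) : Set where
  field
    0∈ : S 0
    +-closed : ∀ {x y} → S x → S y → S (x + y)

  *-closed : ∀ q {x} → S x → S (q * x)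
  *-closed zero    Sx = 0∈
  *-closed (suc q) Sx = +-closed Sx (*-closed q Sx)

⟨⟩-isAdditiveSubmonoid : ∀ a → IsAdditiveSubmonoid ⟨ a ⟩
⟨⟩-isAdditiveSubmonoid a = record
  { 0∈       = 0 , sym (*-zeroʳ a)
  ; +-closed = λ { (m , refl) (n , refl) → m + n , sym (*-distribˡ-+ a m n) }
  }

⊞-isAdditiveSubmonoid : ∀ {A B} → IsAdditiveSubmonoid A → IsAdditiveSubmonoid B →
                        IsAdditiveSubmonoid (A ⊞ B)
⊞-isAdditiveSubmonoid A-sub B-sub = record
  { 0∈       = 0 , 0 , A.0∈ , B.0∈ , refl
  ; +-closed = λ { (y , z , Ay , Bz , refl) (y′ , z′ , Ay′ , Bz′ , refl) →
                   y + y′ , z + z′ , A.+-closed Ay Ay′ , B.+-closed Bz Bz′ , interchange y z y′ z′ }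
  }
  where
  module A = IsAdditiveSubmonoid A-sub
  module B = IsAdditiveSubmonoid B-sub
  interchange : ∀ p q r s → p + q + (r + s) ≡ p + r + (q + s)
  interchange = solve-∀

Gen-isAdditiveSubmonoid : ∀ k (a : Fin k → ℕ) → IsAdditiveSubmonoid (Gen k a)
Gen-isAdditiveSubmonoid zero    a = record { 0∈ = refl ; +-closed = λ { refl refl → refl } }
Gen-isAdditiveSubmonoid (suc k) a =
  ⊞-isAdditiveSubmonoid (⟨⟩-isAdditiveSubmonoid (a fzero)) (Gen-isAdditiveSubmonoid k (a ∘ fsuc))

gcdAll∣Gen : ∀ k (a : Fin k → ℕ) {x} → Gen k a x → gcdAll k a ∣ x
gcdAll∣Gen zero    a refl = ∣-refl
gcdAll∣Gen (suc k) a (_ , v , (n , refl) , Gv , refl) =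
  ∣m∣n⇒∣m+n (∣-trans (gcd[m,n]∣m (a fzero) _) (m∣m*n n))
            (∣-trans (gcd[m,n]∣n (a fzero) _) (gcdAll∣Gen k (a ∘ fsuc) Gv))

gcdAll≢0 : ∀ k (a : Fin (suc k) → ℕ) → a fzero ≢ 0 → gcdAll (suc k) a ≢ 0
gcdAll≢0 k a a₀≢0 = gcd[m,n]≢0 (a fzero) _ (inj₁ a₀≢0)

∣m*n⇒m/gcd[m,n]∣o : ∀ m n o .{{_ : NonZero (gcd m n)}} → m ∣ n * o → m / gcd m n ∣ o
∣m*n⇒m/gcd[m,n]∣o m n o m∣n*o =
  coprime-divisor (coprime-/gcd m n) (m∣n*o⇒m/n∣o (gcd[m,n]∣m m n) (subst (m ∣_) n*o≡ m∣n*o))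
  where
  open ≡-Reasoning
  d = gcd m n
  n*o≡ : n * o ≡ n / d * o * d
  n*o≡ = begin
    n * o           ≡⟨ cong (_* o) (m/n*n≡m (gcd[m,n]∣n m n)) ⟨
    n / d * d * o   ≡⟨ *-assoc (n / d) d o ⟩
    n / d * (d * o) ≡⟨ cong (n / d *_) (*-comm d o) ⟩
    n / d * (o * d) ≡⟨ *-assoc (n / d) o d ⟨
    n / d * o * d   ∎

∣∧<⇒≡0 : ∀ {m n} → m ∣ n → n < m → n ≡ 0
∣∧<⇒≡0 {n = zero}  _   _   = refl
∣∧<⇒≡0 {n = suc _} m∣n n<m = ⊥-elim (>⇒∤ n<m m∣n)

module _ {S : NSet} (S-sub : IsAdditiveSubmonoid S) {b c : ℕ} .{{_ : NonZero c}} where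
  open IsAdditiveSubmonoid S-sub

  ⊞⟨⟩≐⊞Remainders : S (b * c) → (S ⊞ ⟨ b ⟩) ≐ (S ⊞ Remainders b c)
  ⊞⟨⟩≐⊞Remainders Sbc x = reduce , enlarge
    where
    shift : ∀ s n → s + b * n ≡ (s + n / c * (b * c)) + b * (n % c)
    shift s n = begin
      s + b * n                               ≡⟨ cong (λ m → s + b * m) (m≡m%n+[m/n]*n n c) ⟩
      s + b * (n % c + n / c * c)             ≡⟨ regroup s b (n % c) (n / c) c ⟩
      (s + n / c * (b * c)) + b * (n % c)     ∎
      where
      open ≡-Reasoning
      regroup : ∀ s b r q c → s + b * (r + q * c) ≡ (s + q * (b * c)) + b * r
      regroup = solve-∀

    reduce : (S ⊞ ⟨ b ⟩) x → (S ⊞ Remainders b c) x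
    reduce (s , _ , Ss , (n , refl) , refl) =
      s + n / c * (b * c) , b * (n % c) , +-closed Ss (*-closed (n / c) Sbc) ,
      (n % c , m%n<n n c , refl) , shift s n

    enlarge : (S ⊞ Remainders b c) x → (S ⊞ ⟨ b ⟩) x
    enlarge (s , y , Ss , (r , _ , y≡b*r) , x≡s+y) = s , y , Ss , (r , y≡b*r) , x≡s+y

module _ {S : NSet} {g b c : ℕ} (g∣S : ∀ {x} → S x → g ∣ x) (g∣b*t⇒c∣t : ∀ t → g ∣ b * t → c ∣ t) where

  remainder-≤ : ∀ {y y′ r r′} → S y → S y′ → r ≤ r′ → r′ < c →
                y + b * r ≡ y′ + b * r′ → r′ ≤ r
  remainder-≤ {y} {y′} {r} {r′} Sy Sy′ r≤r′ r′<c eq = m∸n≡0⇒m≤n (∣∧<⇒≡0 c∣t t<c)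
    where
    open ≡-Reasoning
    t = r′ ∸ r
    y≡y′+b*t : y ≡ y′ + b * t
    y≡y′+b*t = +-cancelʳ-≡ (b * r) y (y′ + b * t) (begin
      y + b * r             ≡⟨ eq ⟩
      y′ + b * r′           ≡⟨ cong (λ m → y′ + b * m) (m+[n∸m]≡n r≤r′) ⟨
      y′ + b * (r + t)      ≡⟨ split y′ b r t ⟩
      (y′ + b * t) + b * r  ∎)
      where
      split : ∀ y b r t → y + b * (r + t) ≡ (y + b * t) + b * r
      split = solve-∀
    c∣t : c ∣ t
    c∣t = g∣b*t⇒c∣t t (∣m+n∣m⇒∣n (subst (g ∣_) y≡y′+b*t (g∣S Sy)) (g∣S Sy′))
    t<c : t < c
    t<c = ≤-<-trans (m∸n≤m r′ r) r′<c

  remainders-unique : ∀ y z y′ z′ → S y → Remainders b c z → S y′ → Remainders b c z′ →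
                      y + z ≡ y′ + z′ → (y ≡ y′) × (z ≡ z′)
  remainders-unique y _ y′ _ Sy (r , r<c , refl) Sy′ (r′ , r′<c , refl) eq =
    +-cancelʳ-≡ (b * r) y y′ (subst (λ m → y + b * r ≡ y′ + b * m) (sym r≡r′) eq) , cong (b *_) r≡r′
    where
    r≡r′ : r ≡ r′
    r≡r′ with ≤-total r r′
    ... | inj₁ r≤r′ = ≤-antisym r≤r′ (remainder-≤ Sy Sy′ r≤r′ r′<c eq)
    ... | inj₂ r′≤r = ≤-antisym (remainder-≤ Sy′ Sy r′≤r r<c (sym eq)) r′≤r

corollary5p2 : (k : ℕ) (a : Fin k → ℕ) (b : ℕ) →
    0 < k → (∀ i → 0 < a i) → 0 < b →
    Gen k a (b * cOf k a b) →
    IsDirectSum (Gen k a ⊞ ⟨ b ⟩) (Gen k a) (Remainders b (cOf k a b))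
corollary5p2 (suc k) a b@(suc _) _ a>0 _ Gbc =
  ⊞⟨⟩≐⊞Remainders (Gen-isAdditiveSubmonoid (suc k) a) {b} Gbc ,
  remainders-unique {b = b} (gcdAll∣Gen (suc k) a) (λ t → ∣m*n⇒m/gcd[m,n]∣o g b t)
  where
  g = gcdAll (suc k) a
  instance
    g≢0 : NonZero g
    g≢0 = ≢-nonZero (gcdAll≢0 k a (m<n⇒n≢0 (a>0 fzero)))
    gcd≢0 : NonZero (gcd g b)
    gcd≢0 = ≢-nonZero (gcd[m,n]≢0 g b (inj₂ λ ()))
    c≢0 : NonZero (g / gcd g b)
    c≢0 = ≢-nonZero (m/gcd[m,n]≢0 g b)
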